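{- Let $p$ be a prime and let $a\in\mathbb{N}=\{0,1,2,\ldots\}$. Let $k=k_0+p^ak_1$ with $k_0\in\{0,1,\ldots,p^a-1\}$ and $k_1\in\{1,\ldots,p-1\}$. Define the polynomial $$P_{k_1}(x)=\sum_{j=1}^{k_1}\frac{(-1)^{j-1}}{j}\binom{x}{k_1-j}.$$ Suppose that for each $r=1,\ldots,p-1$ there are integers $n_0\in\{k_0,\ldots,p^a-1\}$ and $n_1\in\{k_1,\ldots,p-1\}$ such that $$\binom{n_1}{k_1}\binom{n_0}{k_0}\equiv r\pmod p\quad\text{and}\quad P_{k_1}(n_1)\not\equiv 0\pmod p.$$ Then, for any $b\in\mathbb{N}$, the set $\{\binom nk:\ n\in\{0,1,\ldots,p^{a+b}-1\}\}$ contains a complete system of residues modulo $p^b$.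
   Context: Since $1\le j\le k_1\le p-1$, the denominators $j$ are invertible modulo $p$, so for an integer $n_1$ the value $P_{k_1}(n_1)$ is a rational number with denominator prime to $p$ (a $p$-adic integer), and the congruence $P_{k_1}(n_1)\not\equiv0\pmod p$ is understood in this sense. -}

module Defs where

open import Data.Nat using (ℕ; zero; suc)
open import Data.Nat.Combinatorics using (_C_)
open import Data.Integer using (ℤ; +_; -_; _^_)
import Data.Integer as ℤ
open import Data.Rational using (ℚ; _/_; 0ℚ; _+_; ↥_)
open import Data.Integer.Divisibility using (_∣_)
open import Relation.Nullary using (¬_)

-- the j-th summand (j ≥ 1) of P_{k1}(x):  (-1)^(j-1) / j * binom(x, k1 - j)
-- written for j = suc i, so (-1)^(j-1) = (-1)^i.
Pterm : ℕ → ℕ → ℕ → ℚ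
Pterm k₁ x i = ((ℤ.- ℤ.1ℤ) ^ i ℤ.* + (x C (k₁ Data.Nat.∸ suc i))) / suc i

Psum : ℕ → ℕ → ℕ → ℚ
Psum k₁ x zero    = 0ℚ
Psum k₁ x (suc m) = Psum k₁ x m + Pterm k₁ x m

P : ℕ → ℕ → ℚ
P k₁ x = Psum k₁ x k₁

infix 4 _≡_[mod_]
_≡_[mod_] : ℤ → ℤ → ℕ → Set
a ≡ b [mod m ] = (+ m) ∣ (a ℤ.- b)

-- for a rational q whose denominator is prime to p (as is the case for P k₁ n₁
-- when k₁ ≤ p - 1), "q ≢ 0 (mod p)" means p does not divide its (reduced) numerator
NonzeroModP : ℚ → ℕ → Set
NonzeroModP q p = ¬ ((+ p) ∣ (↥ q))

-- Write Q = p^a, M = p^(a+1), L = k₁!.  For a base point N = n₀ + Q·n₁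
-- (n₀ < Q, n₁ < p) let H(y) = L·C(N + M·y, k).  The core is a first-order
-- expansion modulo p^(m+2):
--     H(y + p^m·z) ≡ H(y) + p^(m+1)·z·c₀,    c₀ = C(n₀,k₀)·k₁!·P_{k₁}(n₁).
-- It comes from Vandermonde's identity for C(X + Q·R, k): by a Kummer-type
-- bound only the summands with index Q(j+1) survive, absorption turns them into
-- R·(L/(j+1))·C(QR-1, Q(j+1)-1)·C(X, k-Q(j+1)), the middle factor is (-1)^j
-- mod p, and Lucas' theorem evaluates the last one.  If c₀ ≢ 0 (mod p), Hensel
-- lifting turns H(0) ≡ L·s (mod p) into H(y) ≡ L·s (mod p^b), and L is a unit.
-- The hypothesis supplies such a base point when p ∤ s; when p ∣ s one takes
-- n₀ = k₀, n₁ = 0, where C(k₀,k) = 0 and k₁!·P_{k₁}(0) = ±(k₁-1)!.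
module Submission where

open import Data.Nat as ℕ using (ℕ; zero; suc; _+_; _*_; _∸_; _^_; _≤_; _<_; z≤n; s≤s; NonZero; _!; pred)
import Data.Nat.Properties as ℕP
open import Data.Nat.Divisibility as ℕD using (divides; _∣_; _∣?_)
open import Data.Nat.DivMod using (_/_; _%_; m*[n/m]≡n; m%n<n; m≡m%n+[m/n]*n)
open import Data.Nat.Primality using (Prime; euclidsLemma; prime⇒nonZero; prime⇒nonTrivial; prime⇒irreducible)
open import Data.Nat.Coprimality as Coprime using (coprime-Bézout; prime⇒coprime)
open import Data.Nat.GCD using (module Bézout)
open import Data.Nat.Combinatorics using (_C_; nCk+nC[k+1]≡[n+1]C[k+1])
open import Data.Integer as ℤ using (ℤ; +_; 0ℤ; 1ℤ; -1ℤ; -_; _%ℕ_; _/ℕ_)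
import Data.Integer.Properties as ℤP
open import Data.Integer.DivMod using (a≡a%ℕn+[a/ℕn]*n; n%ℕd<d)
import Data.Integer.Divisibility.Signed as ℤD
import Data.Rational as ℚ
import Data.Rational.Properties as ℚP
import Data.Rational.Unnormalised as ℚᵘ
import Data.Rational.Unnormalised.Properties as ℚᵘP
open ℚᵘ using (mkℚᵘ; *≡*)
open import Data.Product using (Σ; ∃; _×_; _,_; proj₁; proj₂)
open import Data.Sum using (_⊎_; inj₁; inj₂)
open import Data.Empty using (⊥-elim)
open import Relation.Nullary using (¬_; yes; no)
open import Relation.Binary.Bundles using (Setoid)
open import Relation.Binary.PropositionalEquality
import Data.Integer.Tactic.RingSolver as ℤ-Solver
import Data.Nat.Tactic.RingSolver as ℕ-Solver
open import Defs using (Psum; Pterm; P; NonzeroModP; _≡_[mod_])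

-- Unlike the library's `_C_`
-- (defined through factorials and division) this computes by pattern
-- matching, so its properties can be proved by plain induction.
binom : ℕ → ℕ → ℕ
binom zero    zero    = 1
binom zero    (suc k) = 0
binom (suc n) zero    = 1
binom (suc n) (suc k) = binom n k + binom n (suc k)

C≡binom : ∀ n k → n C k ≡ binom n k
C≡binom zero    zero    = refl
C≡binom zero    (suc k) = refl
C≡binom (suc n) zero    = refl
C≡binom (suc n) (suc k) =
  trans (sym (nCk+nC[k+1]≡[n+1]C[k+1] n k)) (cong₂ _+_ (C≡binom n k) (C≡binom n (suc k)))

binom-vanish : ∀ {n k} → n < k → binom n k ≡ 0
binom-vanish {zero}  {suc k} _        = refl
binom-vanish {suc n} {suc k} (s≤s lt) =
  cong₂ _+_ (binom-vanish lt) (binom-vanish (ℕP.m<n⇒m<1+n lt))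

binom-n-0 : ∀ n → binom n 0 ≡ 1
binom-n-0 zero    = refl
binom-n-0 (suc n) = refl

binom-n-n : ∀ n → binom n n ≡ 1
binom-n-n zero    = refl
binom-n-n (suc n) =
  trans (cong (λ x → binom n n + x) (binom-vanish (ℕP.n<1+n n))) (trans (ℕP.+-identityʳ _) (binom-n-n n))

binom-n-1 : ∀ n → binom n 1 ≡ n
binom-n-1 zero    = refl
binom-n-1 (suc n) = cong₂ _+_ (binom-n-0 n) (binom-n-1 n)

absorption-suc : ∀ n i → suc i * binom (suc n) (suc i) ≡ suc n * binom n i
absorption-suc zero    zero    = refl
absorption-suc zero    (suc i) = ℕP.*-zeroʳ (suc (suc i))
absorption-suc (suc n) zero    =
  trans (ℕP.*-identityˡ _) (trans (binom-n-1 (suc (suc n))) (sym (ℕP.*-identityʳ _)))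
absorption-suc (suc n) (suc i) = begin
  suc (suc i) * (b (suc i) + binom (suc n) (suc (suc i)))
    ≡⟨ ℕP.*-distribˡ-+ (suc (suc i)) (b (suc i)) _ ⟩
  suc (suc i) * b (suc i) + suc (suc i) * binom (suc n) (suc (suc i))
    ≡⟨ cong (λ x → suc (suc i) * b (suc i) + x) (absorption-suc n (suc i)) ⟩
  b (suc i) + suc i * b (suc i) + suc n * binom n (suc i)
    ≡⟨ cong (λ x → b (suc i) + x + suc n * binom n (suc i)) (absorption-suc n i) ⟩
  b (suc i) + suc n * binom n i + suc n * binom n (suc i)
    ≡⟨ regroup (b (suc i)) (binom n i) (binom n (suc i)) n ⟩
  b (suc i) + suc n * b (suc i)
    ∎
  where
  open ≡-Reasoning
  b : ℕ → ℕ
  b = binom (suc n)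
  regroup : ∀ x y z n → x + suc n * y + suc n * z ≡ x + suc n * (y + z)
  regroup = ℕ-Solver.solve-∀

absorption : ∀ n {i} → 1 ≤ i → i * binom n i ≡ n * binom (n ∸ 1) (i ∸ 1)
absorption zero    {suc i} _ = ℕP.*-zeroʳ (suc i)
absorption (suc n) {suc i} _ = absorption-suc n i

sum : (ℕ → ℤ) → ℕ → ℤ
sum f zero    = 0ℤ
sum f (suc n) = sum f n ℤ.+ f n

sum-zero : ∀ n → sum (λ _ → 0ℤ) n ≡ 0ℤ
sum-zero zero    = refl
sum-zero (suc n) = trans (ℤP.+-identityʳ _) (sum-zero n)

sum-cong : ∀ {f g : ℕ → ℤ} n → (∀ i → i < n → f i ≡ g i) → sum f n ≡ sum g n
sum-cong zero    eq = refl
sum-cong (suc n) eq = cong₂ ℤ._+_ (sum-cong n (λ i lt → eq i (ℕP.m<n⇒m<1+n lt))) (eq n ℕP.≤-refl)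

sum-shift : ∀ (f : ℕ → ℤ) n → sum f (suc n) ≡ f 0 ℤ.+ sum (λ i → f (suc i)) n
sum-shift f zero    = trans (ℤP.+-identityˡ (f 0)) (sym (ℤP.+-identityʳ (f 0)))
sum-shift f (suc n) = trans (cong (ℤ._+ f (suc n)) (sum-shift f n)) (ℤP.+-assoc (f 0) _ _)

sum-+ : ∀ (f g : ℕ → ℤ) n → sum (λ i → f i ℤ.+ g i) n ≡ sum f n ℤ.+ sum g n
sum-+ f g zero    = refl
sum-+ f g (suc n) =
  trans (cong (ℤ._+ (f n ℤ.+ g n)) (sum-+ f g n)) (interchange (sum f n) (sum g n) (f n) (g n))
  where
  interchange : ∀ a b c d → a ℤ.+ b ℤ.+ (c ℤ.+ d) ≡ a ℤ.+ c ℤ.+ (b ℤ.+ d)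
  interchange = ℤ-Solver.solve-∀

sum-*ˡ : ∀ c (f : ℕ → ℤ) n → sum (λ i → c ℤ.* f i) n ≡ c ℤ.* sum f n
sum-*ˡ c f zero    = sym (ℤP.*-zeroʳ c)
sum-*ˡ c f (suc n) = trans (cong (ℤ._+ c ℤ.* f n) (sum-*ˡ c f n)) (sym (ℤP.*-distribˡ-+ c (sum f n) (f n)))

sum-split : ∀ (f : ℕ → ℤ) A n → sum f (A + n) ≡ sum f A ℤ.+ sum (λ t → f (A + t)) n
sum-split f A zero    = trans (cong (sum f) (ℕP.+-identityʳ A)) (sym (ℤP.+-identityʳ _))
sum-split f A (suc n) =
  trans (cong (sum f) (ℕP.+-suc A n))
        (trans (cong (ℤ._+ f (A + n)) (sum-split f A n)) (ℤP.+-assoc (sum f A) _ _))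

sum-blocks : ∀ (f : ℕ → ℤ) Q K → sum f (Q * K) ≡ sum (λ j → sum (λ t → f (Q * j + t)) Q) K
sum-blocks f Q zero    = cong (sum f) (ℕP.*-zeroʳ Q)
sum-blocks f Q (suc K) =
  trans (cong (sum f) (trans (ℕP.*-suc Q K) (ℕP.+-comm Q (Q * K))))
        (trans (sum-split f (Q * K) Q) (cong (ℤ._+ sum (λ t → f (Q * K + t)) Q) (sum-blocks f Q K)))

vandermonde : ∀ X T k → + binom (X + T) k ≡ sum (λ i → + binom X (k ∸ i) ℤ.* + binom T i) (suc k)
vandermonde X zero k = begin
  + binom (X + 0) k                          ≡⟨ cong (λ y → + binom y k) (ℕP.+-identityʳ X) ⟩
  + binom X k                                ≡⟨ sym (ℤP.*-identityʳ _) ⟩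
  + binom X k ℤ.* + 1                        ≡⟨ sym (ℤP.+-identityʳ _) ⟩
  + binom X k ℤ.* + 1 ℤ.+ 0ℤ                 ≡⟨ cong (λ x → + binom X k ℤ.* + 1 ℤ.+ x) (sym (sum-zero k)) ⟩
  + binom X k ℤ.* + 1 ℤ.+ sum (λ _ → 0ℤ) k   ≡⟨ cong (λ x → + binom X k ℤ.* + 1 ℤ.+ x) (sum-cong k (λ i _ → sym (ℤP.*-zeroʳ (+ binom X (k ∸ suc i))))) ⟩
  + binom X k ℤ.* + 1 ℤ.+ sum (λ i → + binom X (k ∸ suc i) ℤ.* 0ℤ) k
                                             ≡⟨ sym (sum-shift _ k) ⟩
  sum (λ i → + binom X (k ∸ i) ℤ.* + binom 0 i) (suc k) ∎
  where open ≡-Reasoning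
vandermonde X (suc T) zero = begin
  + binom (X + suc T) 0         ≡⟨ cong +_ (binom-n-0 (X + suc T)) ⟩
  + 1                           ≡⟨ cong +_ (sym (binom-n-0 X)) ⟩
  + binom X 0                   ≡⟨ sym (ℤP.*-identityʳ _) ⟩
  + binom X 0 ℤ.* + 1           ≡⟨ sym (ℤP.+-identityˡ _) ⟩
  0ℤ ℤ.+ + binom X 0 ℤ.* + 1    ∎
  where open ≡-Reasoning
vandermonde X (suc T) (suc k) = begin
  + binom (X + suc T) (suc k)
    ≡⟨ cong (λ y → + binom y (suc k)) (ℕP.+-suc X T) ⟩
  + (binom (X + T) k + binom (X + T) (suc k))
    ≡⟨ ℤP.pos-+ (binom (X + T) k) _ ⟩
  + binom (X + T) k ℤ.+ + binom (X + T) (suc k)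
    ≡⟨ cong₂ ℤ._+_ (vandermonde X T k) (trans (vandermonde X T (suc k)) (sum-shift _ (suc k))) ⟩
  S₀ ℤ.+ (+ binom X (suc k) ℤ.* + binom T 0 ℤ.+ S₁)
    ≡⟨ cong (λ t → S₀ ℤ.+ (+ binom X (suc k) ℤ.* + t ℤ.+ S₁)) (binom-n-0 T) ⟩
  S₀ ℤ.+ (h ℤ.+ S₁)
    ≡⟨ swap S₀ h S₁ ⟩
  h ℤ.+ (S₀ ℤ.+ S₁)
    ≡⟨ cong (ℤ._+_ h) (sym (sum-+ _ _ (suc k))) ⟩
  h ℤ.+ sum (λ i → + binom X (k ∸ i) ℤ.* + binom T i ℤ.+ + binom X (k ∸ i) ℤ.* + binom T (suc i)) (suc k)
    ≡⟨ cong (ℤ._+_ h) (sum-cong (suc k) (λ i _ → pascal i)) ⟩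
  h ℤ.+ sum (λ i → + binom X (k ∸ i) ℤ.* + binom (suc T) (suc i)) (suc k)
    ≡⟨ sym (sum-shift _ (suc k)) ⟩
  sum (λ i → + binom X (suc k ∸ i) ℤ.* + binom (suc T) i) (suc (suc k)) ∎
  where
  open ≡-Reasoning
  S₀ S₁ h : ℤ
  S₀ = sum (λ i → + binom X (k ∸ i) ℤ.* + binom T i) (suc k)
  S₁ = sum (λ i → + binom X (k ∸ i) ℤ.* + binom T (suc i)) (suc k)
  h  = + binom X (suc k) ℤ.* + 1
  swap : ∀ a b c → a ℤ.+ (b ℤ.+ c) ≡ b ℤ.+ (a ℤ.+ c)
  swap = ℤ-Solver.solve-∀
  pascal : ∀ i → + binom X (k ∸ i) ℤ.* + binom T i ℤ.+ + binom X (k ∸ i) ℤ.* + binom T (suc i)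
               ≡ + binom X (k ∸ i) ℤ.* + binom (suc T) (suc i)
  pascal i = trans (sym (ℤP.*-distribˡ-+ (+ binom X (k ∸ i)) _ _))
                   (cong (+ binom X (k ∸ i) ℤ.*_) (sym (ℤP.pos-+ (binom T i) _)))

-- Congruence of integers modulo m.  It is `x ≡ y [mod m ]` with signed
-- divisibility, wrapped in a record so that x, y and m can be inferred.
infix 4 _≋_⟨mod_⟩
record _≋_⟨mod_⟩ (x y : ℤ) (m : ℕ) : Set where
  constructor mk
  field divides-difference : + m ℤD.∣ x ℤ.- y

≋⇒[mod] : ∀ {m x y} → x ≋ y ⟨mod m ⟩ → x ≡ y [mod m ]
≋⇒[mod] (mk d) = ℤD.∣⇒∣ᵤ d

[mod]⇒≋ : ∀ {m x y} → x ≡ y [mod m ] → x ≋ y ⟨mod m ⟩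
[mod]⇒≋ d = mk (ℤD.∣ᵤ⇒∣ d)

*-distribˡ-- : ∀ c a b → c ℤ.* (a ℤ.- b) ≡ c ℤ.* a ℤ.- c ℤ.* b
*-distribˡ-- = ℤ-Solver.solve-∀

module _ {m : ℕ} where

  ≋-reflexive : ∀ {x y} → x ≡ y → x ≋ y ⟨mod m ⟩
  ≋-reflexive {x} refl = mk (subst (+ m ℤD.∣_) (sym (ℤP.+-inverseʳ x)) (ℤD.∣n⇒∣m*n 0ℤ ℤD.∣-refl))

  ≋-refl : ∀ {x} → x ≋ x ⟨mod m ⟩
  ≋-refl = ≋-reflexive refl

  ≋-sym : ∀ {x y} → x ≋ y ⟨mod m ⟩ → y ≋ x ⟨mod m ⟩
  ≋-sym {x} {y} (mk d) = mk (subst (+ m ℤD.∣_) (negate x y) (ℤD.∣m⇒∣-m d))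
    where
    negate : ∀ x y → ℤ.- (x ℤ.- y) ≡ y ℤ.- x
    negate = ℤ-Solver.solve-∀

  ≋-trans : ∀ {x y z} → x ≋ y ⟨mod m ⟩ → y ≋ z ⟨mod m ⟩ → x ≋ z ⟨mod m ⟩
  ≋-trans {x} {y} {z} (mk d) (mk e) = mk (subst (+ m ℤD.∣_) (telescope x y z) (ℤD.∣m∣n⇒∣m+n d e))
    where
    telescope : ∀ x y z → (x ℤ.- y) ℤ.+ (y ℤ.- z) ≡ x ℤ.- z
    telescope = ℤ-Solver.solve-∀

  ≋-+ : ∀ {a b c d} → a ≋ b ⟨mod m ⟩ → c ≋ d ⟨mod m ⟩ → a ℤ.+ c ≋ b ℤ.+ d ⟨mod m ⟩
  ≋-+ {a} {b} {c} {d} (mk e) (mk f) = mk (subst (+ m ℤD.∣_) (regroup a b c d) (ℤD.∣m∣n⇒∣m+n e f))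
    where
    regroup : ∀ a b c d → (a ℤ.- b) ℤ.+ (c ℤ.- d) ≡ (a ℤ.+ c) ℤ.- (b ℤ.+ d)
    regroup = ℤ-Solver.solve-∀

  ≋-*ˡ : ∀ c {a b} → a ≋ b ⟨mod m ⟩ → c ℤ.* a ≋ c ℤ.* b ⟨mod m ⟩
  ≋-*ˡ c {a} {b} (mk e) = mk (subst (+ m ℤD.∣_) (*-distribˡ-- c a b) (ℤD.∣n⇒∣m*n c e))

  ≋-*ʳ : ∀ c {a b} → a ≋ b ⟨mod m ⟩ → a ℤ.* c ≋ b ℤ.* c ⟨mod m ⟩
  ≋-*ʳ c {a} {b} e = subst₂ (_≋_⟨mod m ⟩) (ℤP.*-comm c a) (ℤP.*-comm c b) (≋-*ˡ c e)

  ≋-* : ∀ {a b c d} → a ≋ b ⟨mod m ⟩ → c ≋ d ⟨mod m ⟩ → a ℤ.* c ≋ b ℤ.* d ⟨mod m ⟩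
  ≋-* {b = b} {c} e f = ≋-trans (≋-*ʳ c e) (≋-*ˡ b f)

  ≋-setoid : Setoid _ _
  ≋-setoid = record
    { Carrier       = ℤ
    ; _≈_           = _≋_⟨mod m ⟩
    ; isEquivalence = record { refl = ≋-refl ; sym = ≋-sym ; trans = ≋-trans }
    }

module ≋-Reasoning (m : ℕ) where
  open import Relation.Binary.Reasoning.Setoid (≋-setoid {m}) public

≋-weaken : ∀ {m n a b} → m ℕD.∣ n → a ≋ b ⟨mod n ⟩ → a ≋ b ⟨mod m ⟩
≋-weaken m∣n (mk d) = mk (ℤD.∣-trans (ℤD.∣ᵤ⇒∣ m∣n) d)

≋-scale : ∀ {m n u v} R → m ℕD.∣ R → u ≋ v ⟨mod n ⟩ → + R ℤ.* u ≋ + R ℤ.* v ⟨mod m * n ⟩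
≋-scale {m} {n} {u} {v} R (divides q refl) (mk (ℤD.divides r eq)) = mk (ℤD.divides (+ q ℤ.* r) (begin
  + (q * m) ℤ.* u ℤ.- + (q * m) ℤ.* v   ≡⟨ sym (*-distribˡ-- (+ (q * m)) u v) ⟩
  + (q * m) ℤ.* (u ℤ.- v)               ≡⟨ cong₂ ℤ._*_ (ℤP.pos-* q m) eq ⟩
  (+ q ℤ.* + m) ℤ.* (r ℤ.* + n)         ≡⟨ rearrange (+ q) (+ m) r (+ n) ⟩
  (+ q ℤ.* r) ℤ.* (+ m ℤ.* + n)         ≡⟨ cong ((+ q ℤ.* r) ℤ.*_) (sym (ℤP.pos-* m n)) ⟩
  (+ q ℤ.* r) ℤ.* + (m * n)             ∎))
  where
  open ≡-Reasoning
  rearrange : ∀ q m r n → (q ℤ.* m) ℤ.* (r ℤ.* n) ≡ (q ℤ.* r) ℤ.* (m ℤ.* n)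
  rearrange = ℤ-Solver.solve-∀

∣⇒≋0 : ∀ {m n} → m ℕD.∣ n → + n ≋ 0ℤ ⟨mod m ⟩
∣⇒≋0 {m} {n} d = mk (subst (+ m ℤD.∣_) (sym (ℤP.+-identityʳ (+ n))) (ℤD.∣ᵤ⇒∣ d))

≋0⇒∣∣ : ∀ {m x} → x ≋ 0ℤ ⟨mod m ⟩ → m ℕD.∣ ℤ.∣ x ∣
≋0⇒∣∣ {m} {x} e = subst (m ℕD.∣_) (cong ℤ.∣_∣ (ℤP.+-identityʳ x)) (≋⇒[mod] e)

∣∣⇒≋0 : ∀ {m x} → m ℕD.∣ ℤ.∣ x ∣ → x ≋ 0ℤ ⟨mod m ⟩
∣∣⇒≋0 {m} {x} m∣x = [mod]⇒≋ (subst (m ℕD.∣_) (cong ℤ.∣_∣ (sym (ℤP.+-identityʳ x))) m∣x)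

*-≋0 : ∀ {m y} x → m ℕD.∣ y → x ℤ.* + y ≋ 0ℤ ⟨mod m ⟩
*-≋0 x m∣y = ≋-trans (≋-*ˡ x (∣⇒≋0 m∣y)) (≋-reflexive (ℤP.*-zeroʳ x))

≋-remainder : ∀ x m .{{_ : NonZero m}} → x ≋ + (x %ℕ m) ⟨mod m ⟩
≋-remainder x m = mk (ℤD.divides (x /ℕ m)
  (trans (cong (ℤ._- + (x %ℕ m)) (a≡a%ℕn+[a/ℕn]*n x m)) (cancel (+ (x %ℕ m)) ((x /ℕ m) ℤ.* + m))))
  where
  cancel : ∀ r s → (r ℤ.+ s) ℤ.- r ≡ s
  cancel = ℤ-Solver.solve-∀

≡+multiple⇒≋ : ∀ {a b y m} → a ≡ b + y * m → + a ≋ + b ⟨mod m ⟩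
≡+multiple⇒≋ {a} {b} {y} {m} refl = mk (ℤD.divides (+ y) (begin
  + (b + y * m) ℤ.- + b       ≡⟨ cong (ℤ._- + b) (ℤP.pos-+ b (y * m)) ⟩
  + b ℤ.+ + (y * m) ℤ.- + b   ≡⟨ cancel (+ b) (+ (y * m)) ⟩
  + (y * m)                   ≡⟨ ℤP.pos-* y m ⟩
  + y ℤ.* + m                 ∎))
  where
  open ≡-Reasoning
  cancel : ∀ r s → r ℤ.+ s ℤ.- r ≡ s
  cancel = ℤ-Solver.solve-∀

sum-≋ : ∀ {m} {f g : ℕ → ℤ} n → (∀ i → i < n → f i ≋ g i ⟨mod m ⟩) → sum f n ≋ sum g n ⟨mod m ⟩
sum-≋ zero    e = ≋-refl
sum-≋ (suc n) e = ≋-+ (sum-≋ n (λ i i<n → e i (ℕP.m<n⇒m<1+n i<n))) (e n ℕP.≤-refl)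

sum-≋0 : ∀ {m} {f : ℕ → ℤ} n → (∀ i → i < n → f i ≋ 0ℤ ⟨mod m ⟩) → sum f n ≋ 0ℤ ⟨mod m ⟩
sum-≋0 zero    e = ≋-refl
sum-≋0 (suc n) e = ≋-+ (sum-≋0 n (λ i i<n → e i (ℕP.m<n⇒m<1+n i<n))) (e n ℕP.≤-refl)

sum-≋-first : ∀ {m} (f : ℕ → ℤ) n → 1 ≤ n → (∀ i → 1 ≤ i → i < n → f i ≋ 0ℤ ⟨mod m ⟩) → sum f n ≋ f 0 ⟨mod m ⟩
sum-≋-first f (suc n) _ e =
  ≋-trans (≋-reflexive (sum-shift f n))
          (≋-trans (≋-+ (≋-refl {x = f 0}) (sum-≋0 n (λ i i<n → e (suc i) (s≤s z≤n) (s≤s i<n))))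
                   (≋-reflexive (ℤP.+-identityʳ (f 0))))

digits-bound : ∀ {A B u v} → u < A → v < B → u + A * v < A * B
digits-bound {A} {B} {u} {v} u<A v<B = begin-strict
  u + A * v     <⟨ ℕP.+-monoˡ-< (A * v) u<A ⟩
  A + A * v     ≡⟨ ℕP.*-suc A v ⟨
  A * suc v     ≤⟨ ℕP.*-monoʳ-≤ A v<B ⟩
  A * B         ∎
  where open ℕP.≤-Reasoning

^-∣-^ : ∀ p {m n} → m ≤ n → p ^ m ∣ p ^ n
^-∣-^ p {m} {n} m≤n = divides (p ^ (n ∸ m)) (begin
  p ^ n               ≡⟨ cong (p ^_) (sym (ℕP.m+[n∸m]≡n m≤n)) ⟩
  p ^ (m + (n ∸ m))   ≡⟨ ℕP.^-distribˡ-+-* p m (n ∸ m) ⟩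
  p ^ m * p ^ (n ∸ m) ≡⟨ ℕP.*-comm (p ^ m) _ ⟩
  p ^ (n ∸ m) * p ^ m ∎)
  where open ≡-Reasoning

<⇒∤ : ∀ {d i} → 1 ≤ i → i < d → ¬ (d ∣ i)
<⇒∤ {d} {suc i} _ i<d d∣i = ℕP.<⇒≱ i<d (ℕD.∣⇒≤ d∣i)

even-or-odd : ∀ n → ∃ (λ w → n ≡ 2 * w) ⊎ ∃ (λ w → n ≡ suc (2 * w))
even-or-odd zero    = inj₁ (0 , refl)
even-or-odd (suc n) with even-or-odd n
... | inj₁ (w , n≡2w)   = inj₂ (w , cong suc n≡2w)
... | inj₂ (w , n≡2w+1) = inj₁ (suc w , trans (cong suc n≡2w+1) (double-suc w))
  where
  double-suc : ∀ w → suc (suc (2 * w)) ≡ 2 * suc w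
  double-suc = ℕ-Solver.solve-∀

prime-2-or-odd : ∀ {p} → Prime p → p ≡ 2 ⊎ ∃ (λ w → p ≡ suc (2 * w))
prime-2-or-odd {p} p-prime with even-or-odd p
... | inj₂ odd       = inj₂ odd
... | inj₁ (w , p≡2w) with prime⇒irreducible p-prime (divides w (trans p≡2w (ℕP.*-comm 2 w)))
...   | inj₁ ()
...   | inj₂ 2≡p = inj₁ (sym 2≡p)

odd-^ : ∀ w a → ∃ (λ v → suc (2 * w) ^ a ≡ suc (2 * v))
odd-^ w zero    = 0 , refl
odd-^ w (suc a) with odd-^ w a
... | v , eq = w + v + 2 * w * v , trans (cong (suc (2 * w) *_) eq) (expand w v)
  where
  expand : ∀ w v → suc (2 * w) * suc (2 * v) ≡ suc (2 * (w + v + 2 * w * v))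
  expand = ℕ-Solver.solve-∀

-1^-even : ∀ n → -1ℤ ℤ.^ (2 * n) ≡ 1ℤ
-1^-even n = trans (sym (ℤP.^-*-assoc -1ℤ 2 n)) (ℤP.^-zeroˡ n)

-1^≋1-mod-2 : ∀ e → -1ℤ ℤ.^ e ≋ 1ℤ ⟨mod 2 ⟩
-1^≋1-mod-2 zero    = ≋-refl
-1^≋1-mod-2 (suc e) = ≋-trans (≋-*ˡ -1ℤ (-1^≋1-mod-2 e)) (mk (ℤD.divides -1ℤ refl))

∣-1^n∣≡1 : ∀ n → ℤ.∣ -1ℤ ℤ.^ n ∣ ≡ 1
∣-1^n∣≡1 zero    = refl
∣-1^n∣≡1 (suc n) = trans (ℤP.abs-* -1ℤ (-1ℤ ℤ.^ n)) (trans (ℕP.+-identityʳ _) (∣-1^n∣≡1 n))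

-- (-1)^(p^a·(j+1) - 1) ≡ (-1)^j (mod p): for odd p both exponents have the
-- same parity, and for p = 2 all signs agree.
sign-of-multiple : ∀ {p} → Prime p → ∀ a j → -1ℤ ℤ.^ (p ^ a * suc j ∸ 1) ≋ -1ℤ ℤ.^ j ⟨mod p ⟩
sign-of-multiple {p} p-prime a j with prime-2-or-odd p-prime
... | inj₁ p≡2 = subst (λ m → -1ℤ ℤ.^ (p ^ a * suc j ∸ 1) ≋ -1ℤ ℤ.^ j ⟨mod m ⟩) (sym p≡2)
                   (≋-trans (-1^≋1-mod-2 (p ^ a * suc j ∸ 1)) (≋-sym (-1^≋1-mod-2 j)))
... | inj₂ (w , p≡2w+1) with odd-^ w a
...   | v , oddᵃ≡2v+1 = ≋-reflexive (begin
  -1ℤ ℤ.^ (p ^ a * suc j ∸ 1)                   ≡⟨ cong (λ n → -1ℤ ℤ.^ n) exponent ⟩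
  -1ℤ ℤ.^ (j + 2 * (v * suc j))                 ≡⟨ ℤP.^-distribˡ-+-* -1ℤ j (2 * (v * suc j)) ⟩
  -1ℤ ℤ.^ j ℤ.* -1ℤ ℤ.^ (2 * (v * suc j))       ≡⟨ cong (-1ℤ ℤ.^ j ℤ.*_) (-1^-even (v * suc j)) ⟩
  -1ℤ ℤ.^ j ℤ.* 1ℤ                              ≡⟨ ℤP.*-identityʳ _ ⟩
  -1ℤ ℤ.^ j                                     ∎)
  where
  open ≡-Reasoning
  expand : ∀ v j → suc (2 * v) * suc j ≡ suc (j + 2 * (v * suc j))
  expand = ℕ-Solver.solve-∀
  exponent : p ^ a * suc j ∸ 1 ≡ j + 2 * (v * suc j)
  exponent = cong (_∸ 1) (trans (cong (λ q → q ^ a * suc j) p≡2w+1)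
                                (trans (cong (_* suc j) oddᵃ≡2v+1) (expand v j)))

!-quotient : ∀ k₁ j → j < k₁ → k₁ ! ≡ suc j * (k₁ ! / suc j)
!-quotient k₁ j j<k₁ = sym (m*[n/m]≡n (ℕD.∣-trans (ℕD.m∣m*n (j !)) (ℕD.m≤n⇒m!∣n! j<k₁)))

-- k₁!·P_{k₁}(x) = Σ_{j<k₁} (-1)^j·(k₁!/(j+1))·C(x, k₁-j-1), which is an integer.
scaledP-term : ℕ → ℕ → ℕ → ℤ
scaledP-term k₁ x j = -1ℤ ℤ.^ j ℤ.* + (k₁ ! / suc j * binom x (k₁ ∸ suc j))

scaledP : ℕ → ℕ → ℤ
scaledP k₁ x = sum (scaledP-term k₁ x) k₁

+-common-denominator : ∀ a x t d e → x ℤ.* + suc d ≡ t ℤ.* + suc e →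
                       (mkℚᵘ a d ℚᵘ.+ mkℚᵘ x e) ℚᵘ.≃ mkℚᵘ (a ℤ.+ t) d
+-common-denominator a x t d e eq = *≡* (begin
  (a ℤ.* + suc e ℤ.+ x ℤ.* + suc d) ℤ.* + suc d       ≡⟨ cong (λ u → (a ℤ.* + suc e ℤ.+ u) ℤ.* + suc d) eq ⟩
  (a ℤ.* + suc e ℤ.+ t ℤ.* + suc e) ℤ.* + suc d       ≡⟨ regroup a t (+ suc e) (+ suc d) ⟩
  (a ℤ.+ t) ℤ.* (+ suc d ℤ.* + suc e)                 ≡⟨ cong ((a ℤ.+ t) ℤ.*_) (sym (ℤP.pos-* (suc d) (suc e))) ⟩
  (a ℤ.+ t) ℤ.* + (suc d * suc e)                     ∎)
  where
  open ≡-Reasoning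
  regroup : ∀ a t e d → (a ℤ.* e ℤ.+ t ℤ.* e) ℤ.* d ≡ (a ℤ.+ t) ℤ.* (d ℤ.* e)
  regroup = ℤ-Solver.solve-∀

module _ (k₁ x : ℕ) where

  private
    L L' : ℕ
    L  = k₁ !
    L' = pred L
    L'+1≡L : suc L' ≡ L
    L'+1≡L = ℕP.suc-pred L {{k₁ ℕP.!≢0}}

  Psum-scaled : ∀ m → m ≤ k₁ → ℚ.toℚᵘ (Psum k₁ x m) ℚᵘ.≃ mkℚᵘ (sum (scaledP-term k₁ x) m) L'
  Psum-scaled zero    _      = *≡* refl
  Psum-scaled (suc m) m<k₁ =
    ℚᵘP.≃-trans (ℚP.toℚᵘ-homo-+ (Psum k₁ x m) (Pterm k₁ x m))
      (ℚᵘP.≃-trans (ℚᵘP.+-cong (Psum-scaled m (ℕP.<⇒≤ m<k₁)) (ℚP.toℚᵘ-fromℚᵘ (mkℚᵘ summand m)))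
                   (+-common-denominator (sum (scaledP-term k₁ x) m) summand (scaledP-term k₁ x m) L' m same-value))
    where
    sign summand : ℤ
    c q : ℕ
    sign = -1ℤ ℤ.^ m
    c    = binom x (k₁ ∸ suc m)
    q    = L / suc m
    summand = sign ℤ.* + (x C (k₁ ∸ suc m))
    reorder : ∀ s c m q → s ℤ.* c ℤ.* (m ℤ.* q) ≡ s ℤ.* (q ℤ.* c) ℤ.* m
    reorder = ℤ-Solver.solve-∀
    same-value : summand ℤ.* + suc L' ≡ scaledP-term k₁ x m ℤ.* + suc m
    same-value = begin
      sign ℤ.* + (x C (k₁ ∸ suc m)) ℤ.* + suc L' ≡⟨ cong₂ (λ u v → sign ℤ.* + u ℤ.* + v) (C≡binom x _) (trans L'+1≡L (!-quotient k₁ m m<k₁)) ⟩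
      sign ℤ.* + c ℤ.* + (suc m * q)              ≡⟨ cong (sign ℤ.* + c ℤ.*_) (ℤP.pos-* (suc m) q) ⟩
      sign ℤ.* + c ℤ.* (+ suc m ℤ.* + q)          ≡⟨ reorder sign (+ c) (+ suc m) (+ q) ⟩
      sign ℤ.* (+ q ℤ.* + c) ℤ.* + suc m          ≡⟨ cong (λ u → sign ℤ.* u ℤ.* + suc m) (sym (ℤP.pos-* q c)) ⟩
      sign ℤ.* + (q * c) ℤ.* + suc m              ∎
      where open ≡-Reasoning

  scaledP-spec : ℚ.↥ (P k₁ x) ℤ.* + (k₁ !) ≡ scaledP k₁ x ℤ.* ℚ.↧ (P k₁ x)
  scaledP-spec with Psum-scaled k₁ ℕP.≤-refl
  ... | *≡* eq = trans (cong₂ ℤ._*_ (sym (ℚP.↥ᵘ-toℚᵘ (P k₁ x))) (cong +_ (sym L'+1≡L)))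
                       (trans eq (cong (scaledP k₁ x ℤ.*_) (ℚP.↧ᵘ-toℚᵘ (P k₁ x))))

-- At x = 0 only the last summand survives:  k!·P_k(0) = (-1)^(k-1)·k!/k.
scaledP-at-0 : ∀ k → scaledP (suc k) 0 ≡ -1ℤ ℤ.^ k ℤ.* + (suc k ! / suc k)
scaledP-at-0 k = begin
  sum (scaledP-term (suc k) 0) k ℤ.+ scaledP-term (suc k) 0 k  ≡⟨ cong₂ ℤ._+_ (trans (sum-cong k earlier) (sum-zero k)) last ⟩
  0ℤ ℤ.+ -1ℤ ℤ.^ k ℤ.* + (suc k ! / suc k)                     ≡⟨ ℤP.+-identityˡ _ ⟩
  -1ℤ ℤ.^ k ℤ.* + (suc k ! / suc k)                            ∎
  where
  open ≡-Reasoning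
  earlier : ∀ j → j < k → scaledP-term (suc k) 0 j ≡ 0ℤ
  earlier j j<k = begin
    -1ℤ ℤ.^ j ℤ.* + (suc k ! / suc j * binom 0 (k ∸ j))   ≡⟨ cong (λ b → -1ℤ ℤ.^ j ℤ.* + (suc k ! / suc j * b)) (binom-vanish (ℕP.m<n⇒0<n∸m j<k)) ⟩
    -1ℤ ℤ.^ j ℤ.* + (suc k ! / suc j * 0)                 ≡⟨ cong (λ n → -1ℤ ℤ.^ j ℤ.* + n) (ℕP.*-zeroʳ (suc k ! / suc j)) ⟩
    -1ℤ ℤ.^ j ℤ.* 0ℤ                                      ≡⟨ ℤP.*-zeroʳ (-1ℤ ℤ.^ j) ⟩
    0ℤ                                                    ∎
  last : scaledP-term (suc k) 0 k ≡ -1ℤ ℤ.^ k ℤ.* + (suc k ! / suc k)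
  last = cong (λ n → -1ℤ ℤ.^ k ℤ.* + n)
              (trans (cong (λ b → suc k ! / suc k * binom 0 b) (ℕP.n∸n≡0 k)) (ℕP.*-identityʳ _))

module ModPrime {p : ℕ} (p-prime : Prime p) where

  instance
    p≢0 : NonZero p
    p≢0 = prime⇒nonZero p-prime

  cancel-coprime : ∀ n {i X} → ¬ (p ∣ i) → p ^ n ∣ i * X → p ^ n ∣ X
  cancel-coprime zero    {i} {X} _   _ = ℕD.1∣ X
  cancel-coprime (suc n) {i} {X} p∤i pⁿ⁺¹∣iX
    with cancel-coprime n p∤i (ℕD.∣-trans (^-∣-^ p (ℕP.n≤1+n n)) pⁿ⁺¹∣iX)
  ... | divides x X≡xpⁿ with euclidsLemma i x p-prime p∣ix
    where
    instance _ = ℕP.m^n≢0 p n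
    p∣ix : p ∣ i * x
    p∣ix = ℕD.*-cancelʳ-∣ (p ^ n)
             (subst (p * p ^ n ∣_) (trans (cong (i *_) X≡xpⁿ) (sym (ℕP.*-assoc i x (p ^ n)))) pⁿ⁺¹∣iX)
  ... | inj₁ p∣i              = ⊥-elim (p∤i p∣i)
  ... | inj₂ (divides y x≡yp) =
    divides y (trans X≡xpⁿ (trans (cong (_* p ^ n) x≡yp) (ℕP.*-assoc y p (p ^ n))))

  strip-factor : ∀ c d {i X} → p ^ (c + d) ∣ i * X → ¬ (p ^ d ∣ i) → p ^ suc c ∣ X
  strip-factor c zero    {i}     _   p⁰∤i = ⊥-elim (p⁰∤i (ℕD.1∣ i))
  strip-factor c (suc d) {i} {X} pᶜ⁺ᵈ∣iX pᵈ∤i with p ∣? i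
  ... | no p∤i =
    ℕD.∣-trans (^-∣-^ p (subst (suc c ≤_) (sym (ℕP.+-suc c d)) (s≤s (ℕP.m≤m+n c d))))
               (cancel-coprime (c + suc d) p∤i pᶜ⁺ᵈ∣iX)
  ... | yes (divides q i≡qp) = strip-factor c d {q} (ℕD.*-cancelˡ-∣ p pp) pᵈ∤q
    where
    shuffle : ∀ q p X → q * p * X ≡ p * (q * X)
    shuffle = ℕ-Solver.solve-∀
    pp : p * p ^ (c + d) ∣ p * (q * X)
    pp = subst₂ _∣_ (cong (p ^_) (ℕP.+-suc c d)) (trans (cong (_* X) i≡qp) (shuffle q p X)) pᶜ⁺ᵈ∣iX
    pᵈ∤q : ¬ (p ^ d ∣ q)
    pᵈ∤q pᵈ∣q = pᵈ∤i (subst₂ _∣_ (ℕP.*-comm (p ^ d) p) (sym i≡qp) (ℕD.*-monoˡ-∣ p pᵈ∣q))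

  ≋-cancel : ∀ e L {x y} → ¬ (p ∣ L) → + L ℤ.* x ≋ + L ℤ.* y ⟨mod p ^ e ⟩ → x ≋ y ⟨mod p ^ e ⟩
  ≋-cancel e L {x} {y} p∤L Lx≋Ly = [mod]⇒≋ (cancel-coprime e p∤L (subst (p ^ e ∣_) factor (≋⇒[mod] Lx≋Ly)))
    where
    factor : ℤ.∣ + L ℤ.* x ℤ.- + L ℤ.* y ∣ ≡ L * ℤ.∣ x ℤ.- y ∣
    factor = trans (cong ℤ.∣_∣ (sym (*-distribˡ-- (+ L) x y))) (ℤP.abs-* (+ L) (x ℤ.- y))

  ∤-factorial : ∀ n → n < p → ¬ (p ∣ n !)
  ∤-factorial zero    _ p∣1 = ℕ.nonTrivial⇒≢1 {{prime⇒nonTrivial p-prime}} (ℕD.∣1⇒≡1 p∣1)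
  ∤-factorial (suc n) n<p p∣n! with euclidsLemma (suc n) (n !) p-prime p∣n!
  ... | inj₁ p∣n+1 = <⇒∤ (s≤s z≤n) n<p p∣n+1
  ... | inj₂ p∣n!  = ∤-factorial n (ℕP.<-trans (ℕP.n<1+n n) n<p) p∣n!

  ≋0-product : ∀ x y → x ℤ.* y ≋ 0ℤ ⟨mod p ⟩ → x ≋ 0ℤ ⟨mod p ⟩ ⊎ y ≋ 0ℤ ⟨mod p ⟩
  ≋0-product x y xy≋0 with euclidsLemma ℤ.∣ x ∣ ℤ.∣ y ∣ p-prime (subst (p ∣_) (ℤP.abs-* x y) (≋0⇒∣∣ xy≋0))
  ... | inj₁ p∣x = inj₁ (∣∣⇒≋0 p∣x)
  ... | inj₂ p∣y = inj₂ (∣∣⇒≋0 p∣y)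

  -- Kummer-type estimate: if p^(c+e) ∣ W and 0 < i with p^e ∤ i, then
  -- p^(c+1) ∣ C(W,i); it follows from  i·C(W,i) = W·C(W-1,i-1).
  binom-divisible : ∀ c e {W i} → p ^ (c + e) ∣ W → 1 ≤ i → ¬ (p ^ e ∣ i) → p ^ suc c ∣ binom W i
  binom-divisible c e {W} {i} pᶜ⁺ᵉ∣W 1≤i pᵉ∤i = strip-factor c e
    (subst (p ^ (c + e) ∣_) (sym (absorption W 1≤i)) (ℕD.∣m⇒∣m*n (binom (W ∸ 1) (i ∸ 1)) pᶜ⁺ᵉ∣W)) pᵉ∤i

  binom-vanish-mod-p : ∀ e {W i} → p ^ e ∣ W → 1 ≤ i → i < p ^ e → p ∣ binom W i
  binom-vanish-mod-p e pᵉ∣W 1≤i i<pᵉ =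
    subst (_∣ _) (ℕP.*-identityʳ p) (binom-divisible 0 e pᵉ∣W 1≤i (<⇒∤ 1≤i i<pᵉ))

  -- Periodicity: adding a multiple of p^e to the top does not change
  -- C(N,κ) mod p for κ < p^e  (Vandermonde; the middle terms vanish).
  binom-periodic : ∀ e N {T κ} → p ^ e ∣ T → κ < p ^ e → + binom (N + T) κ ≋ + binom N κ ⟨mod p ⟩
  binom-periodic e N {T} {κ} pᵉ∣T κ<pᵉ = begin
    + binom (N + T) κ                                     ≡⟨ vandermonde N T κ ⟩
    sum (λ i → + binom N (κ ∸ i) ℤ.* + binom T i) (suc κ) ≈⟨ sum-≋-first _ (suc κ) (s≤s z≤n) middle ⟩
    + binom N κ ℤ.* + binom T 0                           ≡⟨ cong (λ t → + binom N κ ℤ.* + t) (binom-n-0 T) ⟩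
    + binom N κ ℤ.* + 1                                   ≡⟨ ℤP.*-identityʳ (+ binom N κ) ⟩
    + binom N κ                                           ∎
    where
    open ≋-Reasoning p
    middle : ∀ i → 1 ≤ i → i < suc κ → + binom N (κ ∸ i) ℤ.* + binom T i ≋ 0ℤ ⟨mod p ⟩
    middle i 1≤i i≤κ = *-≋0 (+ binom N (κ ∸ i)) (binom-vanish-mod-p e pᵉ∣T 1≤i (ℕP.<-≤-trans i≤κ κ<pᵉ))

  -- "Frobenius": (1+x)^(p^e) ≡ 1 + x^(p^e) (mod p), read off on coefficients.
  binom-frobenius : ∀ e X κ → + binom (X + p ^ e) (p ^ e + κ) ≋ + binom X (p ^ e + κ) ℤ.+ + binom X κ ⟨mod p ⟩
  binom-frobenius e X κ = begin
    + binom (X + Q) (Q + κ)                     ≡⟨ vandermonde X Q (Q + κ) ⟩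
    sum g (suc (Q + κ))                         ≡⟨ cong (sum g) (sym (ℕP.+-suc Q κ)) ⟩
    sum g (Q + suc κ)                           ≡⟨ sum-split g Q (suc κ) ⟩
    sum g Q ℤ.+ sum (λ t → g (Q + t)) (suc κ)   ≈⟨ ≋-+ (sum-≋-first g Q (ℕP.m^n>0 p e) below-Q)
                                                        (sum-≋-first (λ t → g (Q + t)) (suc κ) (s≤s z≤n) above-Q) ⟩
    g 0 ℤ.+ g (Q + 0)                           ≡⟨ cong₂ ℤ._+_ first-term middle-term ⟩
    + binom X (Q + κ) ℤ.+ + binom X κ           ∎
    where
    open ≋-Reasoning p
    Q = p ^ e
    g : ℕ → ℤ
    g i = + binom X ((Q + κ) ∸ i) ℤ.* + binom Q i
    below-Q : ∀ i → 1 ≤ i → i < Q → g i ≋ 0ℤ ⟨mod p ⟩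
    below-Q i 1≤i i<Q = *-≋0 (+ binom X ((Q + κ) ∸ i)) (binom-vanish-mod-p e ℕD.∣-refl 1≤i i<Q)
    above-Q : ∀ t → 1 ≤ t → t < suc κ → g (Q + t) ≋ 0ℤ ⟨mod p ⟩
    above-Q t 1≤t _ = ≋-reflexive (trans (cong (λ b → x ℤ.* + b) (binom-vanish (ℕP.m<m+n Q 1≤t))) (ℤP.*-zeroʳ x))
      where x = + binom X ((Q + κ) ∸ (Q + t))
    first-term : g 0 ≡ + binom X (Q + κ)
    first-term = trans (cong (λ b → + binom X (Q + κ) ℤ.* + b) (binom-n-0 Q)) (ℤP.*-identityʳ (+ binom X (Q + κ)))
    middle-term : g (Q + 0) ≡ + binom X κ
    middle-term =
      trans (cong (λ u → + binom X ((Q + κ) ∸ u) ℤ.* + binom Q u) (ℕP.+-identityʳ Q))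
            (trans (cong₂ (λ u v → + binom X u ℤ.* + v) (ℕP.m+n∸m≡n Q κ) (binom-n-n Q)) (ℤP.*-identityʳ (+ binom X κ)))

  lucas : ∀ a {n₀ k₀} → n₀ < p ^ a → k₀ < p ^ a → ∀ n₁ l →
          + binom (n₀ + p ^ a * n₁) (k₀ + p ^ a * l) ≋ + binom n₀ k₀ ℤ.* + binom n₁ l ⟨mod p ⟩
  lucas a {n₀} {k₀} n₀<Q k₀<Q = go
    where
    Q = p ^ a
    open ≋-Reasoning p
    digit-0 : ∀ x → x + Q * 0 ≡ x
    digit-0 x = trans (cong (_+_ x) (ℕP.*-zeroʳ Q)) (ℕP.+-identityʳ x)
    digit-suc : ∀ x n → x + Q * suc n ≡ (x + Q * n) + Q
    digit-suc x n = solve x Q n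
      where
      solve : ∀ x Q n → x + Q * suc n ≡ (x + Q * n) + Q
      solve = ℕ-Solver.solve-∀
    go : ∀ n₁ l → + binom (n₀ + Q * n₁) (k₀ + Q * l) ≋ + binom n₀ k₀ ℤ.* + binom n₁ l ⟨mod p ⟩
    go zero zero = begin
      + binom (n₀ + Q * 0) (k₀ + Q * 0)  ≡⟨ cong₂ (λ n k → + binom n k) (digit-0 n₀) (digit-0 k₀) ⟩
      + binom n₀ k₀                      ≡⟨ sym (ℤP.*-identityʳ (+ binom n₀ k₀)) ⟩
      + binom n₀ k₀ ℤ.* + binom 0 0      ∎
    go zero (suc l) = begin
      + binom (n₀ + Q * 0) (k₀ + Q * suc l)  ≡⟨ cong +_ (binom-vanish top<bottom) ⟩
      + 0                                    ≡⟨ sym (ℤP.*-zeroʳ (+ binom n₀ k₀)) ⟩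
      + binom n₀ k₀ ℤ.* + binom 0 (suc l)    ∎
      where
      top<bottom : n₀ + Q * 0 < k₀ + Q * suc l
      top<bottom = subst (_< k₀ + Q * suc l) (sym (digit-0 n₀))
        (ℕP.<-≤-trans n₀<Q (ℕP.≤-trans (ℕP.m≤m*n Q (suc l)) (ℕP.m≤n+m (Q * suc l) k₀)))
    go (suc n₁) zero = begin
      + binom (n₀ + Q * suc n₁) (k₀ + Q * 0)  ≡⟨ cong₂ (λ n k → + binom n k) (digit-suc n₀ n₁) (digit-0 k₀) ⟩
      + binom (X + Q) k₀                      ≈⟨ binom-periodic a X ℕD.∣-refl k₀<Q ⟩
      + binom X k₀                            ≡⟨ cong (λ k → + binom X k) (sym (digit-0 k₀)) ⟩
      + binom X (k₀ + Q * 0)                  ≈⟨ go n₁ zero ⟩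
      + binom n₀ k₀ ℤ.* + binom n₁ 0          ≡⟨ cong (λ b → + binom n₀ k₀ ℤ.* + b) (binom-n-0 n₁) ⟩
      + binom n₀ k₀ ℤ.* + binom (suc n₁) 0    ∎
      where X = n₀ + Q * n₁
    go (suc n₁) (suc l) = begin
      + binom (n₀ + Q * suc n₁) (k₀ + Q * suc l)
        ≡⟨ cong₂ (λ n k → + binom n k) (digit-suc n₀ n₁) shifted ⟩
      + binom (X + Q) (Q + κ)
        ≈⟨ binom-frobenius a X κ ⟩
      + binom X (Q + κ) ℤ.+ + binom X κ
        ≡⟨ cong (λ k → + binom X k ℤ.+ + binom X κ) (sym shifted) ⟩
      + binom X (k₀ + Q * suc l) ℤ.+ + binom X κ
        ≈⟨ ≋-+ (go n₁ (suc l)) (go n₁ l) ⟩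
      c ℤ.* + binom n₁ (suc l) ℤ.+ c ℤ.* + binom n₁ l
        ≡⟨ ℤP.+-comm (c ℤ.* + binom n₁ (suc l)) _ ⟩
      c ℤ.* + binom n₁ l ℤ.+ c ℤ.* + binom n₁ (suc l)
        ≡⟨ sym (ℤP.*-distribˡ-+ c (+ binom n₁ l) _) ⟩
      c ℤ.* (+ binom n₁ l ℤ.+ + binom n₁ (suc l))
        ≡⟨ cong (c ℤ.*_) (sym (ℤP.pos-+ (binom n₁ l) _)) ⟩
      c ℤ.* + binom (suc n₁) (suc l)
        ∎
      where
      X κ : ℕ
      c : ℤ
      X = n₀ + Q * n₁
      κ = k₀ + Q * l
      c = + binom n₀ k₀
      shifted : k₀ + Q * suc l ≡ Q + κ
      shifted = trans (digit-suc k₀ l) (ℕP.+-comm κ Q)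

  -- If p^e ∣ W+1 then C(W,l) ≡ (-1)^l (mod p) for l < p^e
  -- (Pascal's rule with C(W+1,l) ≡ 0 for 0 < l < p^e).
  binom-alternating : ∀ e {W} l → p ^ e ∣ suc W → l < p ^ e → + binom W l ≋ -1ℤ ℤ.^ l ⟨mod p ⟩
  binom-alternating e {W} zero    _     _     = ≋-reflexive (cong +_ (binom-n-0 W))
  binom-alternating e {W} (suc l) pᵉ∣W+1 l<pᵉ = begin
    + binom W (suc l)                                 ≡⟨ pascal ⟩
    + binom (suc W) (suc l) ℤ.+ -1ℤ ℤ.* + binom W l   ≈⟨ ≋-+ (∣⇒≋0 (binom-vanish-mod-p e pᵉ∣W+1 (s≤s z≤n) l<pᵉ))
                                                             (≋-*ˡ -1ℤ (binom-alternating e l pᵉ∣W+1 (ℕP.<-trans (ℕP.n<1+n l) l<pᵉ))) ⟩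
    0ℤ ℤ.+ -1ℤ ℤ.* -1ℤ ℤ.^ l                          ≡⟨ ℤP.+-identityˡ _ ⟩
    -1ℤ ℤ.^ suc l                                     ∎
    where
    open ≋-Reasoning p
    cancel : ∀ x y → y ≡ (x ℤ.+ y) ℤ.+ -1ℤ ℤ.* x
    cancel = ℤ-Solver.solve-∀
    pascal : + binom W (suc l) ≡ + binom (suc W) (suc l) ℤ.+ -1ℤ ℤ.* + binom W l
    pascal = trans (cancel (+ binom W l) _) (cong (ℤ._+ -1ℤ ℤ.* + binom W l) (sym (ℤP.pos-+ (binom W l) _)))

  scaledP-nonzero : ∀ k₁ x → ¬ (p ∣ k₁ !) → NonzeroModP (P k₁ x) p →
                    ¬ (scaledP k₁ x ≋ 0ℤ ⟨mod p ⟩)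
  scaledP-nonzero k₁ x p∤k₁! P≢0 scaledP≋0
    with euclidsLemma ℤ.∣ ℚ.↥ (P k₁ x) ∣ (k₁ !) p-prime p∣↥P*k₁!
    where
    p∣↥P*k₁! : p ∣ ℤ.∣ ℚ.↥ (P k₁ x) ∣ * k₁ !
    p∣↥P*k₁! = subst (p ∣_)
      (trans (sym (ℤP.abs-* (scaledP k₁ x) (ℚ.↧ (P k₁ x))))
             (trans (cong ℤ.∣_∣ (sym (scaledP-spec k₁ x))) (ℤP.abs-* (ℚ.↥ (P k₁ x)) (+ (k₁ !)))))
      (ℕD.∣m⇒∣m*n ℤ.∣ ℚ.↧ (P k₁ x) ∣ (≋0⇒∣∣ scaledP≋0))
  ... | inj₁ p∣↥P  = P≢0 p∣↥P
  ... | inj₂ p∣k₁! = p∤k₁! p∣k₁!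

  -- For 1 ≤ k < p, k!·P_k(0) = ±k!/k is a unit modulo p.
  scaledP-at-0-nonzero : ∀ {k} → 1 ≤ k → k < p → ¬ (scaledP k 0 ≋ 0ℤ ⟨mod p ⟩)
  scaledP-at-0-nonzero {suc k} _ k<p scaledP≋0 = ∤-factorial (suc k) k<p
    (subst (p ∣_) (sym (!-quotient (suc k) k (ℕP.n<1+n k))) (ℕD.∣n⇒∣m*n (suc k) p∣q))
    where
    q : ℕ
    q = suc k ! / suc k
    ∣scaledP∣≡q : ℤ.∣ scaledP (suc k) 0 ∣ ≡ q
    ∣scaledP∣≡q = trans (cong ℤ.∣_∣ (scaledP-at-0 k))
                        (trans (ℤP.abs-* (-1ℤ ℤ.^ k) (+ q)) (trans (cong (_* q) (∣-1^n∣≡1 k)) (ℕP.*-identityˡ q)))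
    p∣q : p ∣ q
    p∣q = subst (p ∣_) ∣scaledP∣≡q (≋0⇒∣∣ scaledP≋0)

  ≋-scale-pow : ∀ m R {u v} → p ^ m ∣ R → u ≋ v ⟨mod p ⟩ → + R ℤ.* u ≋ + R ℤ.* v ⟨mod p ^ suc m ⟩
  ≋-scale-pow m R {u} {v} pᵐ∣R u≋v =
    subst (λ n → + R ℤ.* u ≋ + R ℤ.* v ⟨mod n ⟩) (ℕP.*-comm (p ^ m) p) (≋-scale R pᵐ∣R u≋v)

  inverse : ∀ r → 1 ≤ r → r < p → ∃ λ w → + r ℤ.* w ≋ 1ℤ ⟨mod p ⟩
  inverse r@(suc _) _ r<p with coprime-Bézout (Coprime.sym (prime⇒coprime p-prime r<p))
  ... | Bézout.Identity.+- x y eq = + x , (begin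
    + r ℤ.* + x    ≡⟨ sym (ℤP.pos-* r x) ⟩
    + (r * x)      ≈⟨ ≡+multiple⇒≋ {y = y} (trans (ℕP.*-comm r x) (sym eq)) ⟩
    + 1            ∎)
    where open ≋-Reasoning p
  ... | Bézout.Identity.-+ x y eq = - + x , (begin
    + r ℤ.* - + x              ≡⟨ negate (+ r) (+ x) ⟩
    1ℤ ℤ.- (1ℤ ℤ.+ + x ℤ.* + r) ≡⟨ cong (λ t → 1ℤ ℤ.- (1ℤ ℤ.+ t)) (sym (ℤP.pos-* x r)) ⟩
    1ℤ ℤ.- + (1 + x * r)       ≡⟨ cong (λ t → 1ℤ ℤ.- + t) eq ⟩
    1ℤ ℤ.- + (y * p)           ≈⟨ ≋-sym (mk (ℤD.divides (+ y) (trans (cancel 1ℤ (+ (y * p))) (ℤP.pos-* y p)))) ⟩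
    1ℤ                         ∎)
    where
    open ≋-Reasoning p
    negate : ∀ r x → r ℤ.* - x ≡ 1ℤ ℤ.- (1ℤ ℤ.+ x ℤ.* r)
    negate = ℤ-Solver.solve-∀
    cancel : ∀ a t → a ℤ.- (a ℤ.- t) ≡ t
    cancel = ℤ-Solver.solve-∀

  solve-linear : ∀ {c} → ¬ (c ≋ 0ℤ ⟨mod p ⟩) → ∀ q → ∃ λ z → z < p × + z ℤ.* c ℤ.+ q ≋ 0ℤ ⟨mod p ⟩
  solve-linear {c} c≢0 q with c %ℕ p in c%p≡r
  ... | zero    = ⊥-elim (c≢0 (≋-trans (≋-remainder c p) (≋-reflexive (cong +_ c%p≡r))))
  ... | r@(suc _) with inverse r (s≤s z≤n) (subst (_< p) c%p≡r (n%ℕd<d c p))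
  ...   | w , rw≋1 = (- q ℤ.* w) %ℕ p , n%ℕd<d (- q ℤ.* w) p , (begin
    + ((- q ℤ.* w) %ℕ p) ℤ.* c ℤ.+ q  ≈⟨ ≋-+ (≋-* (≋-sym (≋-remainder (- q ℤ.* w) p)) c≋r) (≋-refl {x = q}) ⟩
    (- q ℤ.* w) ℤ.* + r ℤ.+ q         ≡⟨ regroup q w (+ r) ⟩
    q ℤ.+ - q ℤ.* (+ r ℤ.* w)         ≈⟨ ≋-+ (≋-refl {x = q}) (≋-*ˡ (- q) rw≋1) ⟩
    q ℤ.+ - q ℤ.* 1ℤ                  ≡⟨ cancel q ⟩
    0ℤ                                ∎)
    where
    open ≋-Reasoning p
    c≋r : c ≋ + r ⟨mod p ⟩
    c≋r = ≋-trans (≋-remainder c p) (≋-reflexive (cong +_ c%p≡r))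
    regroup : ∀ q w r → (- q ℤ.* w) ℤ.* r ℤ.+ q ≡ q ℤ.+ - q ℤ.* (r ℤ.* w)
    regroup = ℤ-Solver.solve-∀
    cancel : ∀ q → q ℤ.+ - q ℤ.* 1ℤ ≡ 0ℤ
    cancel = ℤ-Solver.solve-∀

  hensel-lift : (H : ℕ → ℤ) (c : ℤ) → ¬ (c ≋ 0ℤ ⟨mod p ⟩) →
    (∀ m y z → H (y + p ^ m * z) ≋ H y ℤ.+ + (p ^ suc m) ℤ.* (+ z ℤ.* c) ⟨mod p ^ suc (suc m) ⟩) →
    ∀ s → H 0 ≋ s ⟨mod p ⟩ → ∀ m → ∃ λ y → y < p ^ m × H y ≋ s ⟨mod p ^ suc m ⟩
  hensel-lift H c c≢0 expand s H0≋s zero =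
    0 , s≤s z≤n , ≋-weaken (ℕD.∣-reflexive (ℕP.*-identityʳ p)) H0≋s
  hensel-lift H c c≢0 expand s H0≋s (suc m)
    with hensel-lift H c c≢0 expand s H0≋s m
  ... | y , y<pᵐ , mk (ℤD.divides q Hy-s≡qP) with solve-linear c≢0 q
  ...   | z , z<p , zc+q≋0 = y + p ^ m * z , y'<pᵐ⁺¹ , (begin
    H (y + p ^ m * z)                          ≈⟨ expand m y z ⟩
    H y ℤ.+ pᵐ⁺¹ ℤ.* (+ z ℤ.* c)               ≡⟨ cong (λ h → h ℤ.+ pᵐ⁺¹ ℤ.* (+ z ℤ.* c)) Hy≡s+qpᵐ⁺¹ ⟩
    s ℤ.+ q ℤ.* pᵐ⁺¹ ℤ.+ pᵐ⁺¹ ℤ.* (+ z ℤ.* c)  ≡⟨ regroup s q pᵐ⁺¹ (+ z ℤ.* c) ⟩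
    s ℤ.+ pᵐ⁺¹ ℤ.* (+ z ℤ.* c ℤ.+ q)           ≈⟨ ≋-+ (≋-refl {x = s}) (≋-scale-pow (suc m) (p ^ suc m) ℕD.∣-refl zc+q≋0) ⟩
    s ℤ.+ pᵐ⁺¹ ℤ.* 0ℤ                          ≡⟨ cancel s pᵐ⁺¹ ⟩
    s                                          ∎)
    where
    open ≋-Reasoning (p ^ suc (suc m))
    pᵐ⁺¹ : ℤ
    pᵐ⁺¹ = + (p ^ suc m)
    y'<pᵐ⁺¹ : y + p ^ m * z < p ^ suc m
    y'<pᵐ⁺¹ = subst (y + p ^ m * z <_) (ℕP.*-comm (p ^ m) p) (digits-bound y<pᵐ z<p)
    add-back : ∀ h s → h ≡ s ℤ.+ (h ℤ.- s)
    add-back = ℤ-Solver.solve-∀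
    Hy≡s+qpᵐ⁺¹ : H y ≡ s ℤ.+ q ℤ.* pᵐ⁺¹
    Hy≡s+qpᵐ⁺¹ = trans (add-back (H y) s) (cong (ℤ._+_ s) Hy-s≡qP)
    regroup : ∀ s q t u → s ℤ.+ q ℤ.* t ℤ.+ t ℤ.* u ≡ s ℤ.+ t ℤ.* (u ℤ.+ q)
    regroup = ℤ-Solver.solve-∀
    cancel : ∀ s t → s ℤ.+ t ℤ.* 0ℤ ≡ s
    cancel = ℤ-Solver.solve-∀

module Expansion {p : ℕ} (p-prime : Prime p) (a k₀ k₁ : ℕ) (k₀<Q : k₀ < p ^ a) (k₁<p : k₁ < p) where

  open ModPrime p-prime

  Q M k L : ℕ
  Q = p ^ a
  M = p ^ suc a
  k = k₀ + Q * k₁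
  L = k₁ !

  instance
    Q≢0 : NonZero Q
    Q≢0 = ℕP.m^n≢0 p a

  digits-below-M : ∀ {u d} → u < Q → d < p → u + Q * d < M
  digits-below-M {u} {d} u<Q d<p = subst (u + Q * d <_) (ℕP.*-comm Q p) (digits-bound u<Q d<p)

  k-minus-multiple : ∀ j → j < k₁ → k ∸ Q * suc j ≡ k₀ + Q * (k₁ ∸ suc j)
  k-minus-multiple j j<k₁ = begin
    k₀ + Q * k₁ ∸ Q * suc j                             ≡⟨ cong (λ n → k₀ + Q * n ∸ Q * suc j) (sym (ℕP.m+[n∸m]≡n j<k₁)) ⟩
    k₀ + Q * (suc j + d) ∸ Q * suc j                    ≡⟨ cong (_∸ Q * suc j) (split k₀ Q j d) ⟩
    Q * suc j + (k₀ + Q * d) ∸ Q * suc j                ≡⟨ ℕP.m+n∸m≡n (Q * suc j) _ ⟩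
    k₀ + Q * d                                          ∎
    where
    open ≡-Reasoning
    d : ℕ
    d = k₁ ∸ suc j
    split : ∀ k₀ Q j d → k₀ + Q * (suc j + d) ≡ Q * suc j + (k₀ + Q * d)
    split = ℕ-Solver.solve-∀

  -- First-order coefficient of C(X + Q·R, k) in R:
  -- D(X) = Σ_{j<k₁} (-1)^j (L/(j+1)) C(X, k - Q(j+1)).
  derivative-term : ℕ → ℕ → ℤ
  derivative-term X j = -1ℤ ℤ.^ j ℤ.* + (L / suc j * binom X (k ∸ Q * suc j))

  derivative : ℕ → ℤ
  derivative X = sum (derivative-term X) k₁

  vandermonde-term : ℕ → ℕ → ℕ → ℤ
  vandermonde-term R X i = + L ℤ.* (+ binom X (k ∸ i) ℤ.* + binom (Q * R) i)

  k<M : k < M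
  k<M = digits-below-M k₀<Q k₁<p

  1≤Q* : ∀ n → .{{NonZero n}} → 1 ≤ Q * n
  1≤Q* n = ℕP.<-≤-trans (ℕP.m^n>0 p a) (ℕP.m≤m*n Q n)

  -- C(Q·R-1, Q(j+1)-1) ≡ (-1)^j (mod p) when p ∣ R ≠ 0 (the top is ≡ -1 mod p^(a+1));
  -- multiplied by R, a multiple of p^(m+1), this holds mod p^(m+2), also for R = 0.
  scaled-sign : ∀ m R j → p ^ suc m ∣ R → j < k₁ →
    + R ℤ.* + binom (Q * R ∸ 1) (Q * suc j ∸ 1) ≋ + R ℤ.* -1ℤ ℤ.^ j ⟨mod p ^ suc (suc m) ⟩
  scaled-sign m zero      j _       _   =
    ≋-reflexive (trans (ℤP.*-zeroˡ (+ binom (Q * 0 ∸ 1) (Q * suc j ∸ 1))) (sym (ℤP.*-zeroˡ (-1ℤ ℤ.^ j))))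
  scaled-sign m R@(suc _) j pᵐ⁺¹∣R j<k₁ = ≋-scale-pow (suc m) R pᵐ⁺¹∣R
    (≋-trans (binom-alternating (suc a) (i ∸ 1) M∣QR i-1<M) (sign-of-multiple p-prime a j))
    where
    i : ℕ
    i = Q * suc j
    i-1<M : i ∸ 1 < M
    i-1<M = begin-strict
      i ∸ 1        <⟨ subst (i ∸ 1 <_) (ℕP.m+[n∸m]≡n (1≤Q* (suc j))) ℕP.≤-refl ⟩
      i            ≤⟨ ℕP.*-monoʳ-≤ Q j<k₁ ⟩
      Q * k₁       ≤⟨ ℕP.m≤n+m (Q * k₁) k₀ ⟩
      k            <⟨ k<M ⟩
      M            ∎
      where open ℕP.≤-Reasoning
    p∣R : p ∣ R
    p∣R = ℕD.∣-trans (ℕD.m∣m*n (p ^ m)) pᵐ⁺¹∣R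
    M∣QR : M ∣ suc (Q * R ∸ 1)
    M∣QR = subst (M ∣_) (sym (ℕP.m+[n∸m]≡n (1≤Q* R)))
                 (subst (_∣ Q * R) (ℕP.*-comm Q p) (ℕD.*-monoʳ-∣ Q p∣R))

  module _ (m R : ℕ) (pᵐ⁺¹∣R : p ^ suc m ∣ R) where

    pᵐ⁺¹⁺ᵃ∣QR : p ^ (suc m + a) ∣ Q * R
    pᵐ⁺¹⁺ᵃ∣QR = subst (_∣ Q * R) (trans (ℕP.*-comm Q _) (sym (ℕP.^-distribˡ-+-* p (suc m) a)))
                      (ℕD.*-monoʳ-∣ Q pᵐ⁺¹∣R)

    term-vanishes : ∀ X i → 1 ≤ i → ¬ (Q ∣ i) → vandermonde-term R X i ≋ 0ℤ ⟨mod p ^ suc (suc m) ⟩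
    term-vanishes X i 1≤i Q∤i =
      ≋-trans (≋-*ˡ (+ L) (*-≋0 (+ binom X (k ∸ i)) (binom-divisible (suc m) a pᵐ⁺¹⁺ᵃ∣QR 1≤i Q∤i)))
              (≋-reflexive (ℤP.*-zeroʳ (+ L)))

    -- At a multiple i = Q(j+1) of Q, absorption gives (j+1)·C(QR,i) = R·C(QR-1,i-1),
    -- so the summand is R times the j-th term of the derivative, mod p^(m+2).
    term-at-multiple : ∀ X j → j < k₁ →
      vandermonde-term R X (Q * suc j) ≋ + R ℤ.* derivative-term X j ⟨mod p ^ suc (suc m) ⟩
    term-at-multiple X j j<k₁ =
      ≋-trans (≋-reflexive exact) (≋-trans (≋-*ˡ (+ q ℤ.* c) (scaled-sign m R j pᵐ⁺¹∣R j<k₁)) (≋-reflexive reorder))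
      where
      open ≡-Reasoning
      T i q C b : ℕ
      c : ℤ
      T = Q * R
      i = Q * suc j
      q = L / suc j
      C = binom X (k ∸ i)
      c = + C
      b = binom (T ∸ 1) (i ∸ 1)
      absorbed : suc j * binom T i ≡ R * b
      absorbed = ℕP.*-cancelˡ-≡ _ _ Q (begin
        Q * (suc j * binom T i)   ≡⟨ ℕP.*-assoc Q (suc j) _ ⟨
        i * binom T i             ≡⟨ absorption T (1≤Q* (suc j)) ⟩
        T * b                     ≡⟨ ℕP.*-assoc Q R b ⟩
        Q * (R * b)               ∎)
      L-absorbed : L * binom T i ≡ q * (R * b)
      L-absorbed = trans (cong (_* binom T i) (!-quotient k₁ j j<k₁))
                         (trans (shuffle (suc j) q (binom T i)) (cong (q *_) absorbed))
        where
        shuffle : ∀ s q t → s * q * t ≡ q * (s * t)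
        shuffle = ℕ-Solver.solve-∀
      move : ∀ l c t → l ℤ.* (c ℤ.* t) ≡ c ℤ.* (l ℤ.* t)
      move = ℤ-Solver.solve-∀
      regroup : ∀ c q r b → c ℤ.* (q ℤ.* (r ℤ.* b)) ≡ q ℤ.* c ℤ.* (r ℤ.* b)
      regroup = ℤ-Solver.solve-∀
      exact : + L ℤ.* (c ℤ.* + binom T i) ≡ + q ℤ.* c ℤ.* (+ R ℤ.* + b)
      exact = begin
        + L ℤ.* (c ℤ.* + binom T i)       ≡⟨ move (+ L) c _ ⟩
        c ℤ.* (+ L ℤ.* + binom T i)       ≡⟨ cong (c ℤ.*_) (sym (ℤP.pos-* L _)) ⟩
        c ℤ.* + (L * binom T i)           ≡⟨ cong (λ n → c ℤ.* + n) L-absorbed ⟩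
        c ℤ.* + (q * (R * b))             ≡⟨ cong (c ℤ.*_) (trans (ℤP.pos-* q _) (cong (+ q ℤ.*_) (ℤP.pos-* R b))) ⟩
        c ℤ.* (+ q ℤ.* (+ R ℤ.* + b))     ≡⟨ regroup c (+ q) (+ R) (+ b) ⟩
        + q ℤ.* c ℤ.* (+ R ℤ.* + b)       ∎
      reorder′ : ∀ q c r s → q ℤ.* c ℤ.* (r ℤ.* s) ≡ r ℤ.* (s ℤ.* (q ℤ.* c))
      reorder′ = ℤ-Solver.solve-∀
      reorder : + q ℤ.* c ℤ.* (+ R ℤ.* -1ℤ ℤ.^ j) ≡ + R ℤ.* derivative-term X j
      reorder = trans (reorder′ (+ q) c (+ R) (-1ℤ ℤ.^ j))
                      (cong (λ n → + R ℤ.* (-1ℤ ℤ.^ j ℤ.* n)) (sym (ℤP.pos-* q C)))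

    -- Split the Vandermonde sum into blocks of length Q; in each block only the
    -- summand at the multiple of Q survives.
    expansion : ∀ X → + (L * binom (X + Q * R) k) ≋ + (L * binom X k) ℤ.+ + R ℤ.* derivative X ⟨mod p ^ suc (suc m) ⟩
    expansion X = begin
      + (L * binom (X + Q * R) k)
        ≡⟨ trans (ℤP.pos-* L _) (cong (+ L ℤ.*_) (vandermonde X (Q * R) k)) ⟩
      + L ℤ.* sum (λ i → + binom X (k ∸ i) ℤ.* + binom (Q * R) i) (suc k)
        ≡⟨ sym (sum-*ˡ (+ L) _ (suc k)) ⟩
      sum f (suc k)
        ≡⟨ cong (sum f) (trans (cong suc (ℕP.+-comm k₀ (Q * k₁))) (sym (ℕP.+-suc (Q * k₁) k₀))) ⟩
      sum f (Q * k₁ + suc k₀)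
        ≡⟨ sum-split f (Q * k₁) (suc k₀) ⟩
      sum f (Q * k₁) ℤ.+ sum (λ t → f (Q * k₁ + t)) (suc k₀)
        ≡⟨ cong (ℤ._+ sum (λ t → f (Q * k₁ + t)) (suc k₀)) (sum-blocks f Q k₁) ⟩
      sum (λ j → sum (λ t → f (Q * j + t)) Q) k₁ ℤ.+ sum (λ t → f (Q * k₁ + t)) (suc k₀)
        ≈⟨ ≋-+ (sum-≋ k₁ (λ j _ → full-block j)) last-block ⟩
      sum (λ j → f (Q * j + 0)) (suc k₁)
        ≡⟨ sum-shift _ k₁ ⟩
      f (Q * 0 + 0) ℤ.+ sum (λ j → f (Q * suc j + 0)) k₁
        ≈⟨ ≋-+ (≋-reflexive first) (sum-≋ k₁ multiples) ⟩
      + (L * binom X k) ℤ.+ sum (λ j → + R ℤ.* derivative-term X j) k₁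
        ≡⟨ cong (ℤ._+_ (+ (L * binom X k))) (sum-*ˡ (+ R) (derivative-term X) k₁) ⟩
      + (L * binom X k) ℤ.+ + R ℤ.* derivative X
        ∎
      where
      open ≋-Reasoning (p ^ suc (suc m))
      f : ℕ → ℤ
      f = vandermonde-term R X
      off-multiple : ∀ j t → 1 ≤ t → t < Q → f (Q * j + t) ≋ 0ℤ ⟨mod p ^ suc (suc m) ⟩
      off-multiple j t 1≤t t<Q = term-vanishes X (Q * j + t) (ℕP.≤-trans 1≤t (ℕP.m≤n+m t (Q * j)))
        (λ Q∣Qj+t → <⇒∤ 1≤t t<Q (ℕD.∣m+n∣m⇒∣n Q∣Qj+t (ℕD.m∣m*n j)))
      full-block : ∀ j → sum (λ t → f (Q * j + t)) Q ≋ f (Q * j + 0) ⟨mod p ^ suc (suc m) ⟩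
      full-block j = sum-≋-first _ Q (ℕP.m^n>0 p a) (off-multiple j)
      last-block : sum (λ t → f (Q * k₁ + t)) (suc k₀) ≋ f (Q * k₁ + 0) ⟨mod p ^ suc (suc m) ⟩
      last-block = sum-≋-first _ (suc k₀) (s≤s z≤n)
        (λ t 1≤t t≤k₀ → off-multiple k₁ t 1≤t (ℕP.<-≤-trans t≤k₀ k₀<Q))
      first : f (Q * 0 + 0) ≡ + (L * binom X k)
      first = trans (cong f (trans (ℕP.+-identityʳ (Q * 0)) (ℕP.*-zeroʳ Q)))
        (trans (cong (λ n → + L ℤ.* (+ binom X k ℤ.* + n)) (binom-n-0 (Q * R)))
        (trans (cong (+ L ℤ.*_) (ℤP.*-identityʳ (+ binom X k))) (sym (ℤP.pos-* L (binom X k)))))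
      multiples : ∀ j → j < k₁ → f (Q * suc j + 0) ≋ + R ℤ.* derivative-term X j ⟨mod p ^ suc (suc m) ⟩
      multiples j j<k₁ = ≋-trans (≋-reflexive (cong f (ℕP.+-identityʳ (Q * suc j)))) (term-at-multiple X j j<k₁)

  module Lift (n₀ n₁ : ℕ) (n₀<Q : n₀ < Q) where

    N : ℕ
    N = n₀ + Q * n₁

    c₀ : ℤ
    c₀ = + binom n₀ k₀ ℤ.* scaledP k₁ n₁

    H : ℕ → ℤ
    H y = + (L * binom (N + M * y) k)

    -- Along the lifts, D(N + M·y) ≡ c₀ (mod p): periodicity and Lucas, termwise.
    derivative-at-lift : ∀ y → derivative (N + M * y) ≋ c₀ ⟨mod p ⟩
    derivative-at-lift y = begin
      sum (derivative-term X) k₁                                ≈⟨ sum-≋ k₁ termwise ⟩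
      sum (λ j → + binom n₀ k₀ ℤ.* scaledP-term k₁ n₁ j) k₁     ≡⟨ sum-*ˡ (+ binom n₀ k₀) (scaledP-term k₁ n₁) k₁ ⟩
      c₀                                                        ∎
      where
      open ≋-Reasoning p
      X : ℕ
      X = N + M * y
      regroup : ∀ s q c b → s ℤ.* (q ℤ.* (c ℤ.* b)) ≡ c ℤ.* (s ℤ.* (q ℤ.* b))
      regroup = ℤ-Solver.solve-∀
      termwise : ∀ j → j < k₁ → derivative-term X j ≋ + binom n₀ k₀ ℤ.* scaledP-term k₁ n₁ j ⟨mod p ⟩
      termwise j j<k₁ = begin
        sign ℤ.* + (q * binom X (k ∸ Q * suc j))                 ≡⟨ cong (sign ℤ.*_) (ℤP.pos-* q _) ⟩
        sign ℤ.* (+ q ℤ.* + binom X (k ∸ Q * suc j))             ≡⟨ cong (λ i → sign ℤ.* (+ q ℤ.* + binom X i)) (k-minus-multiple j j<k₁) ⟩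
        sign ℤ.* (+ q ℤ.* + binom (N + M * y) (k₀ + Q * d))      ≈⟨ ≋-*ˡ sign (≋-*ˡ (+ q) (≋-trans
                                                                      (binom-periodic (suc a) N (ℕD.m∣m*n y) (digits-below-M k₀<Q d<p))
                                                                      (lucas a n₀<Q k₀<Q n₁ d))) ⟩
        sign ℤ.* (+ q ℤ.* (+ binom n₀ k₀ ℤ.* + binom n₁ d))      ≡⟨ regroup sign (+ q) (+ binom n₀ k₀) (+ binom n₁ d) ⟩
        + binom n₀ k₀ ℤ.* (sign ℤ.* (+ q ℤ.* + binom n₁ d))      ≡⟨ cong (λ t → + binom n₀ k₀ ℤ.* (sign ℤ.* t)) (sym (ℤP.pos-* q _)) ⟩
        + binom n₀ k₀ ℤ.* scaledP-term k₁ n₁ j                   ∎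
        where
        sign : ℤ
        q d : ℕ
        sign = -1ℤ ℤ.^ j
        q = L / suc j
        d = k₁ ∸ suc j
        d<p : d < p
        d<p = ℕP.≤-<-trans (ℕP.m∸n≤m k₁ (suc j)) k₁<p

    H-step : ∀ m y z → H (y + p ^ m * z) ≋ H y ℤ.+ + (p ^ suc m) ℤ.* (+ z ℤ.* c₀) ⟨mod p ^ suc (suc m) ⟩
    H-step m y z = begin
      H (y + p ^ m * z)                                ≡⟨ cong (λ n → + (L * binom n k)) (shift N p Q y (p ^ m) z) ⟩
      + (L * binom (N + M * y + Q * R) k)              ≈⟨ expansion m R (ℕD.m∣m*n z) (N + M * y) ⟩
      H y ℤ.+ + R ℤ.* derivative (N + M * y)           ≈⟨ ≋-+ (≋-refl {x = H y}) (≋-scale-pow (suc m) R (ℕD.m∣m*n z) (derivative-at-lift y)) ⟩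
      H y ℤ.+ + R ℤ.* c₀                               ≡⟨ cong (λ t → H y ℤ.+ t ℤ.* c₀) (ℤP.pos-* (p ^ suc m) z) ⟩
      H y ℤ.+ + (p ^ suc m) ℤ.* + z ℤ.* c₀             ≡⟨ cong (ℤ._+_ (H y)) (ℤP.*-assoc (+ (p ^ suc m)) (+ z) c₀) ⟩
      H y ℤ.+ + (p ^ suc m) ℤ.* (+ z ℤ.* c₀)           ∎
      where
      open ≋-Reasoning (p ^ suc (suc m))
      R = p ^ suc m * z
      shift : ∀ N p Q y pᵐ z → N + p * Q * (y + pᵐ * z) ≡ N + p * Q * y + Q * (p * pᵐ * z)
      shift = ℕ-Solver.solve-∀

  Witness : ℕ → Set
  Witness r = Σ ℕ (λ n₀ → Σ ℕ (λ n₁ → (k₀ ≤ n₀) × (n₀ < p ^ a) × (k₁ ≤ n₁) × (n₁ < p)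
                × ((+ ((n₁ C k₁) * (n₀ C k₀))) ≡ (+ r) [mod p ]) × NonzeroModP (P k₁ n₁) p))

  record StartingPoint (s : ℕ) : Set where
    field
      n₀ n₁ : ℕ
      n₀<Q  : n₀ < Q
      n₁<p  : n₁ < p
      start : Lift.H n₀ n₁ n₀<Q 0 ≋ + (L * s) ⟨mod p ⟩
      c₀≢0  : ¬ (Lift.c₀ n₀ n₁ n₀<Q ≋ 0ℤ ⟨mod p ⟩)

  -- For s ≡ r ≢ 0 (mod p) the witness of the hypothesis is a starting point:
  -- by Lucas H(0) ≡ L·C(n₁,k₁)·C(n₀,k₀) ≡ L·r, and c₀ is a product of units.
  start-from-witness : ∀ {s r} → + s ≋ + r ⟨mod p ⟩ → 1 ≤ r → r < p → Witness r → StartingPoint s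
  start-from-witness {s} {r} s≋r 1≤r r<p (n₀ , n₁ , _ , n₀<Q , _ , n₁<p , C≡r , P≢0) =
    record { n₀ = n₀ ; n₁ = n₁ ; n₀<Q = n₀<Q ; n₁<p = n₁<p ; start = start ; c₀≢0 = c₀≢0 }
    where
    open Lift n₀ n₁ n₀<Q
    product≋r : + binom n₀ k₀ ℤ.* + binom n₁ k₁ ≋ + r ⟨mod p ⟩
    product≋r = ≋-trans (≋-reflexive (trans (sym (ℤP.pos-* (binom n₀ k₀) _)) (cong +_ (trans (ℕP.*-comm (binom n₀ k₀) _)
                  (sym (cong₂ _*_ (C≡binom n₁ k₁) (C≡binom n₀ k₀)))))))
                ([mod]⇒≋ C≡r)
    start : H 0 ≋ + (L * s) ⟨mod p ⟩
    start = begin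
      + (L * binom (N + M * 0) k)    ≡⟨ cong (λ n → + (L * binom n k)) (trans (cong (_+_ N) (ℕP.*-zeroʳ M)) (ℕP.+-identityʳ N)) ⟩
      + (L * binom N k)              ≡⟨ ℤP.pos-* L _ ⟩
      + L ℤ.* + binom N k            ≈⟨ ≋-*ˡ (+ L) (≋-trans (lucas a n₀<Q k₀<Q n₁ k₁) product≋r) ⟩
      + L ℤ.* + r                    ≈⟨ ≋-*ˡ (+ L) (≋-sym s≋r) ⟩
      + L ℤ.* + s                    ≡⟨ ℤP.pos-* L s ⟨
      + (L * s)                      ∎
      where open ≋-Reasoning p
    c₀≢0 : ¬ (c₀ ≋ 0ℤ ⟨mod p ⟩)
    c₀≢0 c₀≋0 with ≋0-product (+ binom n₀ k₀) (scaledP k₁ n₁) c₀≋0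
    ... | inj₁ C≋0 = <⇒∤ 1≤r r<p (≋0⇒∣∣ (≋-trans (≋-sym product≋r)
                       (≋-trans (≋-*ʳ (+ binom n₁ k₁) C≋0) (≋-reflexive (ℤP.*-zeroˡ (+ binom n₁ k₁))))))
    ... | inj₂ scaledP≋0 = scaledP-nonzero k₁ n₁ (∤-factorial k₁ k₁<p) P≢0 scaledP≋0

  -- For s ≡ 0 (mod p) take n₀ = k₀, n₁ = 0: then C(k₀,k) = 0 and c₀ = k₁!·P_{k₁}(0) = ±(k₁-1)!.
  start-from-zero : ∀ {s} → 1 ≤ k₁ → p ∣ s → StartingPoint s
  start-from-zero {s} 1≤k₁ p∣s =
    record { n₀ = k₀ ; n₁ = 0 ; n₀<Q = k₀<Q ; n₁<p = ℕ.>-nonZero⁻¹ p ; start = start ; c₀≢0 = c₀≢0 }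
    where
    open Lift k₀ 0 k₀<Q
    instance
      k₁≢0 : NonZero k₁
      k₁≢0 = ℕ.>-nonZero 1≤k₁
    drop-zeros : ∀ k₀ Q M → k₀ + Q * 0 + M * 0 ≡ k₀
    drop-zeros = ℕ-Solver.solve-∀
    N<k : N + M * 0 < k
    N<k = subst (_< k) (sym (drop-zeros k₀ Q M)) (ℕP.m<m+n k₀ (1≤Q* k₁))
    start : H 0 ≋ + (L * s) ⟨mod p ⟩
    start = ≋-trans (≋-reflexive (cong (λ b → + (L * b)) (binom-vanish N<k)))
                    (≋-trans (≋-reflexive (cong +_ (ℕP.*-zeroʳ L))) (≋-sym (∣⇒≋0 (ℕD.∣n⇒∣m*n L p∣s))))
    c₀≢0 : ¬ (c₀ ≋ 0ℤ ⟨mod p ⟩)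
    c₀≢0 c₀≋0 with ≋0-product (+ binom k₀ k₀) (scaledP k₁ 0) c₀≋0
    ... | inj₁ 1≋0 = ∤-factorial 0 (ℕ.>-nonZero⁻¹ p) (≋0⇒∣∣ (≋-trans (≋-reflexive (cong +_ (sym (binom-n-n k₀)))) 1≋0))
    ... | inj₂ scaledP≋0 = scaledP-at-0-nonzero 1≤k₁ k₁<p scaledP≋0

  starting-point : (∀ r → 1 ≤ r → r < p → Witness r) → 1 ≤ k₁ → ∀ s → StartingPoint s
  starting-point hyp 1≤k₁ s with s % p in s%p≡r
  ... | zero      = start-from-zero 1≤k₁ (ℕD.m%n≡0⇒n∣m s p s%p≡r)
  ... | r@(suc _) = start-from-witness s≋r (s≤s z≤n) r<p (hyp r (s≤s z≤n) r<p)
    where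
    r<p : r < p
    r<p = subst (_< p) s%p≡r (m%n<n s p)
    s≋r : + s ≋ + r ⟨mod p ⟩
    s≋r = ≡+multiple⇒≋ {y = s / p} (trans (m≡m%n+[m/n]*n s p) (cong (_+ s / p * p) s%p≡r))

  -- From a starting point, Hensel lifting gives y < p^m with L·C(N + M·y, k) ≡ L·s
  -- (mod p^(m+1)); cancelling the unit L leaves C(n,k) ≡ s for n = N + M·y < p^(a+m+1).
  lift-solution : ∀ {s} → StartingPoint s → ∀ m →
                  ∃ λ n → n < p ^ (a + suc m) × + binom n k ≋ + s ⟨mod p ^ suc m ⟩
  lift-solution {s} point m = N + M * y , n<pᵃ⁺ᵐ⁺¹ , C≋s
    where
    open StartingPoint point
    open Lift n₀ n₁ n₀<Q
    lifted : ∃ λ y → y < p ^ m × H y ≋ + (L * s) ⟨mod p ^ suc m ⟩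
    lifted = hensel-lift H c₀ c₀≢0 H-step (+ (L * s)) start m
    y : ℕ
    y = proj₁ lifted
    n<pᵃ⁺ᵐ⁺¹ : N + M * y < p ^ (a + suc m)
    n<pᵃ⁺ᵐ⁺¹ = subst (N + M * y <_) (trans (sym (ℕP.^-distribˡ-+-* p (suc a) m)) (cong (p ^_) (sym (ℕP.+-suc a m))))
                     (digits-bound (digits-below-M n₀<Q n₁<p) (proj₁ (proj₂ lifted)))
    C≋s : + binom (N + M * y) k ≋ + s ⟨mod p ^ suc m ⟩
    C≋s = ≋-cancel (suc m) L (∤-factorial k₁ k₁<p)
            (subst₂ (_≋_⟨mod p ^ suc m ⟩) (ℤP.pos-* L _) (ℤP.pos-* L s) (proj₂ (proj₂ lifted)))

  residue-attained : (∀ r → 1 ≤ r → r < p → Witness r) → 1 ≤ k₁ → ∀ s m →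
                     ∃ λ n → n < p ^ (a + suc m) × + (n C k) ≡ + s [mod p ^ suc m ]
  residue-attained hyp 1≤k₁ s m = n , n<pᵃ⁺ᵐ⁺¹ , ≋⇒[mod] C≋s
    where
    solution : ∃ λ n → n < p ^ (a + suc m) × + binom n k ≋ + s ⟨mod p ^ suc m ⟩
    solution = lift-solution (starting-point hyp 1≤k₁ s) m
    n : ℕ
    n = proj₁ solution
    n<pᵃ⁺ᵐ⁺¹ : n < p ^ (a + suc m)
    n<pᵃ⁺ᵐ⁺¹ = proj₁ (proj₂ solution)
    C≋s : + (n C k) ≋ + s ⟨mod p ^ suc m ⟩
    C≋s = subst (λ c → + c ≋ + s ⟨mod p ^ suc m ⟩) (sym (C≡binom n k)) (proj₂ (proj₂ solution))

theorem1p2 : (p : ℕ) → Prime p → (a k₀ k₁ : ℕ) → k₀ < p ^ a → 1 ≤ k₁ → k₁ < p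
    → ((r : ℕ) → 1 ≤ r → r < p
    → Σ ℕ (λ n₀ → Σ ℕ (λ n₁ → (k₀ ≤ n₀) × (n₀ < p ^ a) × (k₁ ≤ n₁) × (n₁ < p)
    × ((+ ((n₁ C k₁) * (n₀ C k₀))) ≡ (+ r) [mod p ]) × NonzeroModP (P k₁ n₁) p)))
    → (b : ℕ) → (s : ℕ) → s < p ^ b
    → Σ ℕ (λ n → (n < p ^ (a + b)) × ((+ (n C (k₀ + p ^ a * k₁))) ≡ (+ s) [mod (p ^ b) ]))
theorem1p2 p p-prime a k₀ k₁ k₀<Q 1≤k₁ k₁<p hyp zero    s _ =
  0 , ℕP.m^n>0 p {{prime⇒nonZero p-prime}} (a + 0) , ℕD.1∣ _
theorem1p2 p p-prime a k₀ k₁ k₀<Q 1≤k₁ k₁<p hyp (suc m) s _ =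
  Expansion.residue-attained p-prime a k₀ k₁ k₀<Q k₁<p hyp 1≤k₁ s m
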